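{- Let $\mathfrak{A}\in\mathrm{REL}$ be a perfect algebra and $a$ an atom of $\mathfrak{A}$ with $\breve{a}\neq0$. Then: (1) if $st(a)\neq0$ then $end(\breve{a})\neq0$ and $\mathcal{E}\breve{a}=\mathcal{S}a$; (2) if $end(a)\neq0$ then $st(\breve{a})\neq0$ and $\mathcal{S}\breve{a}=\mathcal{E}a$; (3) if $st(a)\neq0$ then $\mathcal{S}a\le a;\breve{a}$; (4) if $end(a)\neq0$ then $\mathcal{E}a\le\breve{a};a$.
   Context: $\mathrm{REL}$ is the class of algebras $\mathfrak{A}=\langle A,+,\cdot,-,0,1,;,\breve{\ },1'\rangle$ (binary $;$, unary converse $x\mapsto\breve{x}$, constant $1'$) satisfying: (Ax1) $\langle A,+,\cdot,-,0,1\rangle$ is a Boolean algebra; (Ax2) $(x\cdot\breve{y})\breve{}=\breve{x}\cdot y$; (Ax3) $(x+y);z=x;z+y;z$ and $x;(y+z)=x;y+x;z$; (Ax4) $1;0=0$ and $0;1=0$; (Ax5) $(\breve{x};y)\cdot z=(\breve{x};(y\cdot(\breve{\breve{x}};z)))\cdot z$ and $(x;\breve{y})\cdot z=((x\cdot(z;\breve{\breve{y}}));\breve{y})\cdot z$; (Ax6) $1';x\le x$ and $x;1'\le x$; (Ax7) $1';1'=1'$; (Ax8) $(-(\breve{1});-(\breve{1}))\cdot 1'=0$; (Ax9) $((x\cdot1');y);z=(x\cdot1');(y;z)$, $(x;(y\cdot1'));z=x;((y\cdot1');z)$ and $(x;y);(z\cdot1')=x;(y;(z\cdot1'))$. An algebra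 $\mathfrak{A}\in\mathrm{REL}$ is perfect if it is complete and atomic and its converse and composition operations are completely additive. For an atom $a$, $st(a)=1';a$ and $end(a)=a;1'$. In a perfect $\mathfrak{A}\in\mathrm{REL}$: if $st(a)\neq0$, $\mathcal{S}a$ denotes the unique atom $a^-\le1'$ with $a^-;a=a$; if $end(a)\neq0$, $\mathcal{E}a$ denotes the unique atom $a^-\le1'$ with $a;a^-=a$ (these exist and are unique). -}

module Defs where

open import Level using (0ℓ)
open import Data.Product using (Σ; ∃; _×_; _,_)
open import Data.Sum using (_⊎_)
open import Relation.Nullary using (¬_)
open import Relation.Unary using (Pred)
open import Relation.Binary.PropositionalEquality using (_≡_)
import Algebra.Lattice.Structures as LS

record REL : Set₁ where
  infixl 6 _+_
  infixl 7 _·_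
  infixl 8 _⨾_
  infix  9 _˘
  field
    Carrier : Set
    _+_ _·_ : Carrier → Carrier → Carrier
    -_      : Carrier → Carrier
    𝟘 𝟙     : Carrier
    _⨾_     : Carrier → Carrier → Carrier
    _˘      : Carrier → Carrier
    𝟙'      : Carrier
    ax1  : LS.IsBooleanAlgebra {A = Carrier} _≡_ _+_ _·_ -_ 𝟙 𝟘
    ax2  : ∀ x y → (x · y ˘) ˘ ≡ x ˘ · y
    ax3l : ∀ x y z → (x + y) ⨾ z ≡ x ⨾ z + y ⨾ z
    ax3r : ∀ x y z → x ⨾ (y + z) ≡ x ⨾ y + x ⨾ z
    ax4l : 𝟙 ⨾ 𝟘 ≡ 𝟘
    ax4r : 𝟘 ⨾ 𝟙 ≡ 𝟘
    ax5l : ∀ x y z → (x ˘ ⨾ y) · z ≡ (x ˘ ⨾ (y · (x ˘ ˘ ⨾ z))) · z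
    ax5r : ∀ x y z → (x ⨾ y ˘) · z ≡ ((x · (z ⨾ y ˘ ˘)) ⨾ y ˘) · z
    -- (Ax6)  (x ≤ y  means  x + y ≡ y)
    ax6l : ∀ x → 𝟙' ⨾ x + x ≡ x
    ax6r : ∀ x → x ⨾ 𝟙' + x ≡ x
    ax7  : 𝟙' ⨾ 𝟙' ≡ 𝟙'
    ax8  : ((- (𝟙 ˘)) ⨾ (- (𝟙 ˘))) · 𝟙' ≡ 𝟘
    ax9a : ∀ x y z → ((x · 𝟙') ⨾ y) ⨾ z ≡ (x · 𝟙') ⨾ (y ⨾ z)
    ax9b : ∀ x y z → (x ⨾ (y · 𝟙')) ⨾ z ≡ x ⨾ ((y · 𝟙') ⨾ z)
    ax9c : ∀ x y z → (x ⨾ y) ⨾ (z · 𝟙') ≡ x ⨾ (y ⨾ (z · 𝟙'))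

module RELNotions (𝔄 : REL) where
  open REL 𝔄

  infix 4 _≤_
  _≤_ : Carrier → Carrier → Set
  x ≤ y = x + y ≡ y

  IsAtom : Carrier → Set
  IsAtom a = ¬ (a ≡ 𝟘) × (∀ x → x ≤ a → x ≡ 𝟘 ⊎ x ≡ a)

  IsSup : Pred Carrier 0ℓ → Carrier → Set
  IsSup S s = (∀ x → S x → x ≤ s) × (∀ u → (∀ x → S x → x ≤ u) → s ≤ u)

  Img : (Carrier → Carrier) → Pred Carrier 0ℓ → Pred Carrier 0ℓ
  Img f S y = ∃ λ x → S x × y ≡ f x

  Complete : Set₁
  Complete = ∀ (S : Pred Carrier 0ℓ) → ∃ λ s → IsSup S s

  Atomic : Set
  Atomic = ∀ x → ¬ (x ≡ 𝟘) → ∃ λ a → IsAtom a × a ≤ x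

  CompletelyAdditive : (Carrier → Carrier) → Set₁
  CompletelyAdditive f = ∀ (S : Pred Carrier 0ℓ) s → IsSup S s → IsSup (Img f S) (f s)

  Perfect : Set₁
  Perfect = Complete × Atomic × CompletelyAdditive _˘
          × (∀ y → CompletelyAdditive (λ x → x ⨾ y))
          × (∀ y → CompletelyAdditive (λ x → y ⨾ x))

  st end : Carrier → Carrier
  st a  = 𝟙' ⨾ a
  end a = a ⨾ 𝟙'

  Is𝓢 : Carrier → Carrier → Set
  Is𝓢 a s = IsAtom s × s ≤ 𝟙' × s ⨾ a ≡ a

  Is𝓔 : Carrier → Carrier → Set
  Is𝓔 a e = IsAtom e × e ≤ 𝟙' × a ⨾ e ≡ a

module Submission where

open import Defs
open import Level using (0ℓ)
open import Data.Product using (_×_; _,_; proj₁; proj₂)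
open import Data.Sum using (inj₁; inj₂)
open import Data.Empty using (⊥-elim)
open import Relation.Nullary using (¬_)
open import Relation.Unary using (Pred)
open import Relation.Binary.PropositionalEquality
open import Algebra.Lattice.Bundles using (BooleanAlgebra)
import Algebra.Lattice.Properties.BooleanAlgebra as BooleanAlgebraProperties
import Algebra.Lattice.Properties.Lattice as LatticeProperties

-- Ax5 (the Dedekind law) applied to s ; a ≡ a shows that the subidentity atom
-- 𝓢a meets a ; a˘, hence lies below it; applied once more it gives
-- a˘ ; 𝓢a ≢ 𝟘, which forces every candidate for 𝓔a˘ to be 𝓢a. Perfectness
-- turns st a ≢ 𝟘 into a subidentity atom s with s ; a ≢ 𝟘, necessarily 𝓢a,
-- and a˘ ; 𝓢a ≤ end a˘ then rules out end a˘ ≡ 𝟘. Reversing composition gives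
-- again an algebra in REL, in which st and end, 𝓢 and 𝓔 trade places; this
-- yields the statements about end a.

module RELProperties (𝔄 : REL) where
  open REL 𝔄
  open RELNotions 𝔄
  open ≡-Reasoning

  booleanAlgebra : BooleanAlgebra 0ℓ 0ℓ
  booleanAlgebra = record
    { _≈_ = _≡_ ; _∨_ = _+_ ; _∧_ = _·_ ; ¬_ = -_ ; ⊤ = 𝟙 ; ⊥ = 𝟘
    ; isBooleanAlgebra = ax1 }

  open BooleanAlgebra booleanAlgebra
    using (∨-comm; ∧-comm; ∧-assoc; ∨-absorbs-∧; ∧-absorbs-∨; ∧-distribˡ-∨;
           ∧-complementʳ; ∨-complementʳ; lattice)
  open BooleanAlgebraProperties booleanAlgebra
    using (∧-zeroˡ; ∧-zeroʳ; ∨-identityʳ; ∧-identityˡ; ∧-identityʳ; ∨-zeroʳ)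
  open LatticeProperties lattice using (∧-idem; ∨-idem)

  ≤⇒·≡ : ∀ {x y} → x ≤ y → x · y ≡ x
  ≤⇒·≡ {x} {y} x≤y = trans (cong (x ·_) (sym x≤y)) (∧-absorbs-∨ x y)

  ·≡⇒≤ : ∀ {x y} → x · y ≡ x → x ≤ y
  ·≡⇒≤ {x} {y} x·y≡x = begin
    x + y        ≡⟨ cong (_+ y) (sym x·y≡x) ⟩
    x · y + y    ≡⟨ ∨-comm (x · y) y ⟩
    y + x · y    ≡⟨ cong (y +_) (∧-comm x y) ⟩
    y + y · x    ≡⟨ ∨-absorbs-∧ y x ⟩
    y            ∎

  ≤-reflexive : ∀ {x y} → x ≡ y → x ≤ y
  ≤-reflexive {x} refl = ∨-idem x

  ≤-trans : ∀ {x y z} → x ≤ y → y ≤ z → x ≤ z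
  ≤-trans {x} {y} {z} x≤y y≤z = ·≡⇒≤ (begin
    x · z        ≡⟨ cong (_· z) (sym (≤⇒·≡ x≤y)) ⟩
    x · y · z    ≡⟨ ∧-assoc x y z ⟩
    x · (y · z)  ≡⟨ cong (x ·_) (≤⇒·≡ y≤z) ⟩
    x · y        ≡⟨ ≤⇒·≡ x≤y ⟩
    x            ∎)

  ≤-antisym : ∀ {x y} → x ≤ y → y ≤ x → x ≡ y
  ≤-antisym {x} {y} x≤y y≤x = trans (sym y≤x) (trans (∨-comm y x) x≤y)

  x·y≤x : ∀ x y → x · y ≤ x
  x·y≤x x y = ·≡⇒≤ (begin
    x · y · x    ≡⟨ ∧-comm (x · y) x ⟩
    x · (x · y)  ≡⟨ sym (∧-assoc x x y) ⟩
    x · x · y    ≡⟨ cong (_· y) (∧-idem x) ⟩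
    x · y        ∎)

  x·y≤y : ∀ x y → x · y ≤ y
  x·y≤y x y = ·≡⇒≤ (trans (∧-assoc x y y) (cong (x ·_) (∧-idem y)))

  ·-greatest : ∀ {x y z} → x ≤ y → x ≤ z → x ≤ y · z
  ·-greatest {x} {y} {z} x≤y x≤z =
    ·≡⇒≤ (trans (sym (∧-assoc x y z)) (trans (cong (_· z) (≤⇒·≡ x≤y)) (≤⇒·≡ x≤z)))

  ≤𝟘⇒≡𝟘 : ∀ {x} → x ≤ 𝟘 → x ≡ 𝟘
  ≤𝟘⇒≡𝟘 {x} x≤𝟘 = trans (sym (∨-identityʳ x)) x≤𝟘

  ≤𝟙 : ∀ x → x ≤ 𝟙
  ≤𝟙 = ∨-zeroʳ

  ≤∧≤-⇒≡𝟘 : ∀ {x y} → x ≤ y → x ≤ - y → x ≡ 𝟘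
  ≤∧≤-⇒≡𝟘 {x} {y} x≤y x≤-y = begin
    x              ≡⟨ sym (≤⇒·≡ (·-greatest x≤y x≤-y)) ⟩
    x · (y · - y)  ≡⟨ cong (x ·_) (∧-complementʳ y) ⟩
    x · 𝟘          ≡⟨ ∧-zeroʳ x ⟩
    𝟘              ∎

  ·-≡𝟘⇒≤ : ∀ {x y} → x · - y ≡ 𝟘 → x ≤ y
  ·-≡𝟘⇒≤ {x} {y} x·-y≡𝟘 = ·≡⇒≤ (sym (begin
    x                    ≡⟨ sym (∧-identityʳ x) ⟩
    x · 𝟙                ≡⟨ cong (x ·_) (sym (∨-complementʳ y)) ⟩
    x · (y + - y)        ≡⟨ ∧-distribˡ-∨ x y (- y) ⟩
    x · y + x · - y      ≡⟨ cong (x · y +_) x·-y≡𝟘 ⟩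
    x · y + 𝟘            ≡⟨ ∨-identityʳ (x · y) ⟩
    x · y                ∎))

  atom-≤⇒≡ : ∀ {a x} → IsAtom a → x ≤ a → ¬ x ≡ 𝟘 → x ≡ a
  atom-≤⇒≡ {x = x} (_ , below) x≤a x≢𝟘 with below x x≤a
  ... | inj₁ x≡𝟘 = ⊥-elim (x≢𝟘 x≡𝟘)
  ... | inj₂ x≡a = x≡a

  ⨾-monoˡ-≤ : ∀ {x y} z → x ≤ y → x ⨾ z ≤ y ⨾ z
  ⨾-monoˡ-≤ {x} {y} z x≤y = trans (sym (ax3l x y z)) (cong (_⨾ z) x≤y)

  ⨾-monoʳ-≤ : ∀ {x y} z → x ≤ y → z ⨾ x ≤ z ⨾ y
  ⨾-monoʳ-≤ {x} {y} z x≤y = trans (sym (ax3r z x y)) (cong (z ⨾_) x≤y)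

  ⨾-zeroʳ : ∀ x → x ⨾ 𝟘 ≡ 𝟘
  ⨾-zeroʳ x = ≤𝟘⇒≡𝟘 (subst (x ⨾ 𝟘 ≤_) ax4l (⨾-monoˡ-≤ 𝟘 (≤𝟙 x)))

  ⨾-zeroˡ : ∀ x → 𝟘 ⨾ x ≡ 𝟘
  ⨾-zeroˡ x = ≤𝟘⇒≡𝟘 (subst (𝟘 ⨾ x ≤_) ax4r (⨾-monoʳ-≤ 𝟘 (≤𝟙 x)))

  subid⨾≤ : ∀ {s} x → s ≤ 𝟙' → s ⨾ x ≤ x
  subid⨾≤ x s≤𝟙' = ≤-trans (⨾-monoˡ-≤ x s≤𝟙') (ax6l x)

  ⨾subid≤ : ∀ {s} x → s ≤ 𝟙' → x ⨾ s ≤ x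
  ⨾subid≤ x s≤𝟙' = ≤-trans (⨾-monoʳ-≤ x s≤𝟙') (ax6r x)

  ⨾-assoc-subid : ∀ {z} x y → z ≤ 𝟙' → (x ⨾ y) ⨾ z ≡ x ⨾ (y ⨾ z)
  ⨾-assoc-subid {z} x y z≤𝟙' =
    subst (λ w → (x ⨾ y) ⨾ w ≡ x ⨾ (y ⨾ w)) (≤⇒·≡ z≤𝟙') (ax9c x y z)

  subid-atoms-⨾≢𝟘⇒≡ : ∀ {e s} → IsAtom e → e ≤ 𝟙' → IsAtom s → s ≤ 𝟙' →
                       ¬ e ⨾ s ≡ 𝟘 → e ≡ s
  subid-atoms-⨾≢𝟘⇒≡ {e} {s} atom-e e≤𝟙' atom-s s≤𝟙' e⨾s≢𝟘 =
    trans (sym (atom-≤⇒≡ atom-e (x·y≤x e s) e·s≢𝟘)) (atom-≤⇒≡ atom-s (x·y≤y e s) e·s≢𝟘)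
    where
    e·s≢𝟘 : ¬ e · s ≡ 𝟘
    e·s≢𝟘 e·s≡𝟘 = e⨾s≢𝟘 (≤𝟘⇒≡𝟘 (subst (e ⨾ s ≤_) e·s≡𝟘
      (·-greatest (⨾subid≤ e s≤𝟙') (subid⨾≤ s e≤𝟙'))))

  ˘-zero : 𝟘 ˘ ≡ 𝟘
  ˘-zero = begin
    𝟘 ˘            ≡⟨ cong _˘ (sym (∧-zeroˡ (𝟘 ˘))) ⟩
    (𝟘 · 𝟘 ˘) ˘    ≡⟨ ax2 𝟘 𝟘 ⟩
    𝟘 ˘ · 𝟘        ≡⟨ ∧-zeroʳ (𝟘 ˘) ⟩
    𝟘              ∎

  ˘˘≡𝟙˘· : ∀ x → x ˘ ˘ ≡ 𝟙 ˘ · x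
  ˘˘≡𝟙˘· x = trans (cong _˘ (sym (∧-identityˡ (x ˘)))) (ax2 𝟙 x)

  ˘≡[·𝟙˘]˘ : ∀ x → x ˘ ≡ (x · 𝟙 ˘) ˘
  ˘≡[·𝟙˘]˘ x = sym (trans (ax2 x 𝟙) (∧-identityʳ (x ˘)))

  atom-˘˘ : ∀ {a} → IsAtom a → ¬ a ˘ ≡ 𝟘 → a ˘ ˘ ≡ a
  atom-˘˘ {a} atom-a a˘≢𝟘 = trans (˘˘≡𝟙˘· a) (atom-≤⇒≡ atom-a (x·y≤y (𝟙 ˘) a) 𝟙˘·a≢𝟘)
    where
    𝟙˘·a≢𝟘 : ¬ 𝟙 ˘ · a ≡ 𝟘
    𝟙˘·a≢𝟘 𝟙˘·a≡𝟘 = a˘≢𝟘 (begin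
      a ˘              ≡⟨ ˘≡[·𝟙˘]˘ a ⟩
      (a · 𝟙 ˘) ˘      ≡⟨ cong _˘ (trans (∧-comm a (𝟙 ˘)) 𝟙˘·a≡𝟘) ⟩
      𝟘 ˘              ≡⟨ ˘-zero ⟩
      𝟘                ∎)

  ⨾-modularˡ : ∀ {x} → x ˘ ˘ ≡ x → ∀ y z → (x ⨾ y) · z ≡ (x ⨾ (y · (x ˘ ⨾ z))) · z
  ⨾-modularˡ {x} x˘˘≡x y z =
    subst (λ w → (w ⨾ y) · z ≡ (w ⨾ (y · (w ˘ ⨾ z))) · z) x˘˘≡x (ax5l (x ˘) y z)

  ⨾-modularʳ : ∀ {x} → x ˘ ˘ ≡ x → ∀ y z → (y ⨾ x) · z ≡ ((y · (z ⨾ x ˘)) ⨾ x) · z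
  ⨾-modularʳ {x} x˘˘≡x y z =
    subst (λ w → (y ⨾ w) · z ≡ ((y · (z ⨾ w ˘)) ⨾ w) · z) x˘˘≡x (ax5r y (x ˘) z)

  module _ {a} (atom-a : IsAtom a) (a˘≢𝟘 : ¬ a ˘ ≡ 𝟘) where

    a˘˘≡a : a ˘ ˘ ≡ a
    a˘˘≡a = atom-˘˘ atom-a a˘≢𝟘

    𝓢·⨾˘≢𝟘 : ∀ {s} → Is𝓢 a s → ¬ s · (a ⨾ a ˘) ≡ 𝟘
    𝓢·⨾˘≢𝟘 {s} (_ , _ , s⨾a≡a) s·a⨾a˘≡𝟘 = proj₁ atom-a (begin
      a                               ≡⟨ sym (∧-idem a) ⟩
      a · a                           ≡⟨ cong (_· a) (sym s⨾a≡a) ⟩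
      (s ⨾ a) · a                     ≡⟨ ⨾-modularʳ a˘˘≡a s a ⟩
      ((s · (a ⨾ a ˘)) ⨾ a) · a       ≡⟨ cong (λ w → (w ⨾ a) · a) s·a⨾a˘≡𝟘 ⟩
      (𝟘 ⨾ a) · a                     ≡⟨ cong (_· a) (⨾-zeroˡ a) ⟩
      𝟘 · a                           ≡⟨ ∧-zeroˡ a ⟩
      𝟘                               ∎)

    𝓢≤⨾˘ : ∀ {s} → Is𝓢 a s → s ≤ a ⨾ a ˘
    𝓢≤⨾˘ 𝓢s@(atom-s , _ , _) = ·≡⇒≤ (atom-≤⇒≡ atom-s (x·y≤x _ _) (𝓢·⨾˘≢𝟘 𝓢s))

    ˘⨾𝓢≢𝟘 : ∀ {s} → Is𝓢 a s → ¬ a ˘ ⨾ s ≡ 𝟘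
    ˘⨾𝓢≢𝟘 {s} 𝓢s a˘⨾s≡𝟘 = 𝓢·⨾˘≢𝟘 𝓢s (begin
      s · (a ⨾ a ˘)                   ≡⟨ ∧-comm s (a ⨾ a ˘) ⟩
      (a ⨾ a ˘) · s                   ≡⟨ ⨾-modularˡ a˘˘≡a (a ˘) s ⟩
      (a ⨾ (a ˘ · (a ˘ ⨾ s))) · s     ≡⟨ cong (λ w → (a ⨾ (a ˘ · w)) · s) a˘⨾s≡𝟘 ⟩
      (a ⨾ (a ˘ · 𝟘)) · s             ≡⟨ cong (λ w → (a ⨾ w) · s) (∧-zeroʳ (a ˘)) ⟩
      (a ⨾ 𝟘) · s                     ≡⟨ cong (_· s) (⨾-zeroʳ a) ⟩
      𝟘 · s                           ≡⟨ ∧-zeroˡ s ⟩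
      𝟘                               ∎)

    𝓔˘≡𝓢 : ∀ {s e} → Is𝓢 a s → Is𝓔 (a ˘) e → e ≡ s
    𝓔˘≡𝓢 {s} {e} 𝓢s@(atom-s , s≤𝟙' , _) (atom-e , e≤𝟙' , a˘⨾e≡a˘) =
      subid-atoms-⨾≢𝟘⇒≡ atom-e e≤𝟙' atom-s s≤𝟙' λ e⨾s≡𝟘 → ˘⨾𝓢≢𝟘 𝓢s (begin
        a ˘ ⨾ s            ≡⟨ cong (_⨾ s) (sym a˘⨾e≡a˘) ⟩
        (a ˘ ⨾ e) ⨾ s      ≡⟨ ⨾-assoc-subid (a ˘) e s≤𝟙' ⟩
        a ˘ ⨾ (e ⨾ s)      ≡⟨ cong (a ˘ ⨾_) e⨾s≡𝟘 ⟩
        a ˘ ⨾ 𝟘            ≡⟨ ⨾-zeroʳ (a ˘) ⟩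
        𝟘                  ∎)

  -- The subidentities killed by f have a supremum t that f still kills; an
  -- atom below 1' · - t would be a subidentity atom not killed by f.
  subid-atom-witness : Complete → Atomic → ∀ f → CompletelyAdditive f → ¬ f 𝟙' ≡ 𝟘 →
                       ¬ (∀ s → IsAtom s → s ≤ 𝟙' → ¬ ¬ f s ≡ 𝟘)
  subid-atom-witness complete atomic f additive f𝟙'≢𝟘 killed =
    ¬¬𝟙'·-t≡𝟘 λ 𝟙'·-t≡𝟘 → f𝟙'≢𝟘 (trans (cong f (≤-antisym (·-≡𝟘⇒≤ 𝟙'·-t≡𝟘) t≤𝟙')) ft≡𝟘)
    where
    Killed : Pred Carrier 0ℓ
    Killed x = x ≤ 𝟙' × f x ≡ 𝟘

    t : Carrier
    t = proj₁ (complete Killed)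

    t-sup : IsSup Killed t
    t-sup = proj₂ (complete Killed)

    t≤𝟙' : t ≤ 𝟙'
    t≤𝟙' = proj₂ t-sup 𝟙' (λ _ → proj₁)

    ft≡𝟘 : f t ≡ 𝟘
    ft≡𝟘 = ≤𝟘⇒≡𝟘 (proj₂ (additive Killed t t-sup) 𝟘
      λ { _ (_ , (_ , fx≡𝟘) , y≡fx) → ≤-reflexive (trans y≡fx fx≡𝟘) })

    ¬¬𝟙'·-t≡𝟘 : ¬ ¬ 𝟙' · - t ≡ 𝟘
    ¬¬𝟙'·-t≡𝟘 𝟙'·-t≢𝟘 with atomic _ 𝟙'·-t≢𝟘
    ... | s , atom-s , s≤𝟙'·-t = killed s atom-s s≤𝟙' λ fs≡𝟘 →
      proj₁ atom-s (≤∧≤-⇒≡𝟘 (proj₁ t-sup s (s≤𝟙' , fs≡𝟘)) (≤-trans s≤𝟙'·-t (x·y≤y 𝟙' (- t))))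
      where
      s≤𝟙' : s ≤ 𝟙'
      s≤𝟙' = ≤-trans s≤𝟙'·-t (x·y≤x 𝟙' (- t))

  end˘≢𝟘 : Perfect → ∀ {a} → IsAtom a → ¬ a ˘ ≡ 𝟘 → ¬ st a ≡ 𝟘 → ¬ end (a ˘) ≡ 𝟘
  end˘≢𝟘 (complete , atomic , _ , ⨾-additiveˡ , _) {a} atom-a a˘≢𝟘 st≢𝟘 end˘≡𝟘 =
    subid-atom-witness complete atomic (_⨾ a) (⨾-additiveˡ a) st≢𝟘
      λ s atom-s s≤𝟙' s⨾a≢𝟘 →
        ˘⨾𝓢≢𝟘 atom-a a˘≢𝟘 (atom-s , s≤𝟙' , atom-≤⇒≡ atom-a (subid⨾≤ a s≤𝟙') s⨾a≢𝟘)
          (≤𝟘⇒≡𝟘 (subst (a ˘ ⨾ s ≤_) end˘≡𝟘 (⨾-monoʳ-≤ (a ˘) s≤𝟙')))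

op : REL → REL
op 𝔄 = record
  { Carrier = Carrier ; _+_ = _+_ ; _·_ = _·_ ; -_ = -_ ; 𝟘 = 𝟘 ; 𝟙 = 𝟙
  ; _⨾_ = λ x y → y ⨾ x ; _˘ = _˘ ; 𝟙' = 𝟙'
  ; ax1 = ax1 ; ax2 = ax2
  ; ax3l = λ x y z → ax3r z x y ; ax3r = λ x y z → ax3l y z x
  ; ax4l = ax4r ; ax4r = ax4l
  ; ax5l = λ x y z → ax5r y x z ; ax5r = λ x y z → ax5l y x z
  ; ax6l = ax6r ; ax6r = ax6l ; ax7 = ax7 ; ax8 = ax8
  ; ax9a = λ x y z → sym (ax9c z y x)
  ; ax9b = λ x y z → sym (ax9b z y x)
  ; ax9c = λ x y z → sym (ax9a z y x) }
  where open REL 𝔄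

op-perfect : ∀ 𝔄 → RELNotions.Perfect 𝔄 → RELNotions.Perfect (op 𝔄)
op-perfect _ (complete , atomic , ˘-additive , ⨾-additiveˡ , ⨾-additiveʳ) =
  complete , atomic , ˘-additive , ⨾-additiveʳ , ⨾-additiveˡ

lemma2p4 : (𝔄 : REL) → RELNotions.Perfect 𝔄 →
    let open REL 𝔄 in let open RELNotions 𝔄 in
    ∀ a → IsAtom a → ¬ (a ˘ ≡ 𝟘) →
      ((¬ (st a ≡ 𝟘) → ¬ (end (a ˘) ≡ 𝟘) × (∀ s e → Is𝓢 a s → Is𝓔 (a ˘) e → e ≡ s))
      × (¬ (end a ≡ 𝟘) → ¬ (st (a ˘) ≡ 𝟘) × (∀ e s → Is𝓔 a e → Is𝓢 (a ˘) s → s ≡ e))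
      × (¬ (st a ≡ 𝟘) → ∀ s → Is𝓢 a s → s ≤ a ⨾ a ˘)
      × (¬ (end a ≡ 𝟘) → ∀ e → Is𝓔 a e → e ≤ a ˘ ⨾ a))
lemma2p4 𝔄 perfect a atom-a a˘≢𝟘 =
  (λ st≢𝟘 → end˘≢𝟘 perfect atom-a a˘≢𝟘 st≢𝟘 , λ _ _ → 𝓔˘≡𝓢 atom-a a˘≢𝟘) ,
  (λ end≢𝟘 → endᵒᵖ˘≢𝟘 (op-perfect 𝔄 perfect) atom-a a˘≢𝟘 end≢𝟘 , λ _ _ → 𝓔ᵒᵖ˘≡𝓢ᵒᵖ atom-a a˘≢𝟘) ,
  (λ _ _ → 𝓢≤⨾˘ atom-a a˘≢𝟘) ,
  (λ _ _ → 𝓢ᵒᵖ≤⨾ᵒᵖ˘ atom-a a˘≢𝟘)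
  where
  open RELProperties 𝔄
  open RELProperties (op 𝔄) using ()
    renaming (end˘≢𝟘 to endᵒᵖ˘≢𝟘; 𝓔˘≡𝓢 to 𝓔ᵒᵖ˘≡𝓢ᵒᵖ; 𝓢≤⨾˘ to 𝓢ᵒᵖ≤⨾ᵒᵖ˘)
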